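{- Let $k\ge 2$ and $n_1,\dots,n_k\ge 3$, and let $H_k=P_{n_1}\,\square\,\cdots\,\square\,P_{n_k}$. Then $\mu_{\rm t}(H_k)=2^k$.
   Context: $P_n$ is the path on $n$ vertices and $\square$ is the Cartesian product of graphs. For a graph $G$ and $X\subseteq V(G)$, vertices $u,v\in V(G)$ are $X$-visible if there exists a shortest $u,v$-path $P$ with $V(P)\cap X\subseteq\{u,v\}$. $X$ is a total mutual-visibility set if every two vertices of $V(G)$ are $X$-visible, and $\mu_{\rm t}(G)$ is the maximum cardinality of a total mutual-visibility set of $G$. -}

module Defs where

open import Data.Nat using (ℕ; zero; suc; _≤_; _^_)
open import Data.Nat.Properties using ()
open import Data.Fin using (Fin; toℕ)
open import Data.Unit using (⊤; tt)
open import Data.Empty using (⊥)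
open import Data.Product using (_×_; _,_; Σ; ∃-syntax)
open import Data.Sum using (_⊎_)
open import Data.List using (List; []; _∷_; length)
open import Data.List.Membership.Propositional using (_∈_)
open import Data.List.Relation.Unary.Unique.Propositional using (Unique)
open import Data.Vec using (Vec; []; _∷_)
open import Relation.Binary.PropositionalEquality using (_≡_)

record Graph : Set₁ where
  field
    V   : Set
    Adj : V → V → Set
open Graph public

P : ℕ → Graph
P n = record { V = Fin n ; Adj = λ i j → (suc (toℕ i) ≡ toℕ j) ⊎ (suc (toℕ j) ≡ toℕ i) }

_□_ : Graph → Graph → Graph
G □ H = record
  { V = V G × V H
  ; Adj = λ { (g , h) (g' , h') → (Adj G g g' × h ≡ h') ⊎ (g ≡ g' × Adj H h h') } }

-- The one-vertex graph K₁ (empty Cartesian product).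
K₁ : Graph
K₁ = record { V = ⊤ ; Adj = λ _ _ → ⊥ }

Grid : ∀ {k} → Vec ℕ k → Graph
Grid [] = K₁
Grid (n ∷ []) = P n
Grid (n ∷ m ∷ ns) = P n □ Grid (m ∷ ns)

module _ (G : Graph) where

  data Walk : V G → V G → Set where
    [] : ∀ {u} → Walk u u
    _∷_ : ∀ {u w v} → Adj G u w → Walk w v → Walk u v

  walkLength : ∀ {u v} → Walk u v → ℕ
  walkLength [] = zero
  walkLength (_ ∷ p) = suc (walkLength p)

  vertices : ∀ {u v} → Walk u v → List (V G)
  vertices {u} [] = u ∷ []
  vertices {u} (_ ∷ p) = u ∷ vertices p

  IsPath : ∀ {u v} → Walk u v → Set
  IsPath p = Unique (vertices p)

  IsShortestPath : ∀ {u v} → Walk u v → Set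
  IsShortestPath {u} {v} p =
    IsPath p × ((q : Walk u v) → IsPath q → walkLength p ≤ walkLength q)

  -- subsets X ⊆ V(G) are duplicate-free lists; |X| = length X
  Visible : List (V G) → V G → V G → Set
  Visible X u v = ∃[ p ] (IsShortestPath {u} {v} p ×
    (∀ x → x ∈ vertices p → x ∈ X → (x ≡ u ⊎ x ≡ v)))

  IsTotalMutualVisibilitySet : List (V G) → Set
  IsTotalMutualVisibilitySet X = ∀ u v → Visible X u v

  μt≡ : ℕ → Set
  μt≡ m =
    (∃[ X ] (Unique X × IsTotalMutualVisibilitySet X × length X ≡ m)) ×
    (∀ X → Unique X → IsTotalMutualVisibilitySet X → length X ≤ m)

{-# OPTIONS --safe #-}
module Submission where

open import Defs
open import Data.Nat using (ℕ; zero; suc; _≤_; _<_; _^_; _+_; _*_; _∸_; ∣_-_∣; s≤s; s≤s⁻¹; z<s)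
open import Data.Fin using (Fin; toℕ; fromℕ; fromℕ<; inject₁; lower₁)
  renaming (zero to fz; suc to fs)
open import Data.Fin.Properties
  using (toℕ-injective; toℕ<n; toℕ-fromℕ<; toℕ-fromℕ; toℕ-inject₁; toℕ-lower₁)
  renaming (_≟_ to _≟ᶠ_)
open import Data.Nat.Properties
open import Data.List using (List; []; _∷_; length; map; _++_; cartesianProduct)
open import Data.List.Properties using (length-map; length-++)
open import Data.List.Membership.Propositional using (_∈_; _∉_)
import Data.List.Membership.DecPropositional
open import Data.List.Membership.Propositional.Properties
  using (∈-map⁻; ∈-cartesianProduct⁺; ∈-cartesianProduct⁻)
open import Data.List.Relation.Unary.Any using (here; there)
open import Data.List.Relation.Unary.AllPairs using ([]; _∷_)
open import Data.List.Relation.Unary.Unique.Propositional using (Unique)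
import Data.List.Relation.Unary.Unique.Propositional.Properties as Unique
import Data.List.Fresh as Fresh
import Data.List.Fresh.Relation.Unary.Any as FreshAny
import Data.List.Fresh.Membership.Setoid as FreshMembership
import Data.List.Fresh.Membership.Setoid.Properties as FreshMembershipProperties
open import Data.Product using (_×_; _,_; proj₁; proj₂; Σ-syntax)
open import Data.Sum using (_⊎_; inj₁; inj₂; [_,_]′; swap)
open import Data.Empty using (⊥; ⊥-elim)
open import Relation.Nullary using (¬_; Dec; yes; no)
import Relation.Nullary.Decidable as Dec
open import Relation.Nullary.Decidable using (_×-dec_)
open import Relation.Binary.PropositionalEquality
open import Algebra.Properties.CommutativeSemigroup +-commutativeSemigroup using (interchange)
open import Function using (_∘_)
open import Data.List.Relation.Unary.All as ListAll using ([]; _∷_)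
open import Data.Vec using (Vec; []; _∷_)
open import Data.Vec.Relation.Unary.All using (All; []; _∷_)

-- The 2^k corners (vertices each of whose coordinates is an end of its path) are
-- mutually visible: a shortest path from (a, g) to (b, h) can move in the first
-- coordinate from a to a waypoint x, then in the others, then from x to b, where x
-- is an inner vertex of P_{n₁} (n₁ ≥ 3) unless a = b or one of a, b is inner
-- itself; such a path meets corners only at its ends. Conversely a non-corner x
-- has an inner coordinate, and moving it one step down and one step up gives two
-- vertices whose only common neighbour is x; every shortest path between them
-- passes through x, so x lies in no total mutual-visibility set. Both properties
-- pass from G and H to G □ H, which gives the induction on k.

module _ {A : Set} where
  open FreshMembership (setoid A) renaming (_∈_ to _∈#_)
  open FreshMembershipProperties (setoid A) using (injection)

  private
    fromUnique : ∀ {xs} → Unique xs → Fresh.List# A _≢_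
    fromUnique = Fresh.fromList

    length-fromList : ∀ {xs} (u : Unique xs) → Fresh.length (fromUnique u) ≡ length xs
    length-fromList [] = refl
    length-fromList (_ ∷ u) = cong suc (length-fromList u)

    ∈-fromList⁺ : ∀ {x xs} (u : Unique xs) → x ∈ xs → x ∈# fromUnique u
    ∈-fromList⁺ (_ ∷ u) (here x≡y) = FreshAny.here x≡y
    ∈-fromList⁺ (_ ∷ u) (there x∈xs) = FreshAny.there (∈-fromList⁺ u x∈xs)

    ∈-fromList⁻ : ∀ {x xs} (u : Unique xs) → x ∈# fromUnique u → x ∈ xs
    ∈-fromList⁻ (_ ∷ u) (FreshAny.here x≡y) = here x≡y
    ∈-fromList⁻ (_ ∷ u) (FreshAny.there x∈xs) = there (∈-fromList⁻ u x∈xs)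

  unique-⊆⇒length≤ : ∀ {xs ys} → Unique xs → Unique ys → (∀ {x} → x ∈ xs → x ∈ ys) →
                     length xs ≤ length ys
  unique-⊆⇒length≤ {xs} {ys} uxs uys xs⊆ys =
    subst₂ _≤_ (length-fromList uxs) (length-fromList uys)
      (injection (λ x≢y → x≢y) (λ x∈xs → ∈-fromList⁺ uys (xs⊆ys (∈-fromList⁻ uxs x∈xs))))

length-cartesianProduct : ∀ {A B : Set} (xs : List A) (ys : List B) →
                          length (cartesianProduct xs ys) ≡ length xs * length ys
length-cartesianProduct [] ys = refl
length-cartesianProduct (x ∷ xs) ys = begin
  length (map (x ,_) ys ++ cartesianProduct xs ys)  ≡⟨ length-++ (map (x ,_) ys) ⟩
  length (map (x ,_) ys) + length (cartesianProduct xs ys)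
    ≡⟨ cong₂ _+_ (length-map (x ,_) ys) (length-cartesianProduct xs ys) ⟩
  length ys + length xs * length ys                  ∎
  where open ≡-Reasoning

Between : ∀ {A : Set} → (A → A → ℕ) → A → A → A → Set
Between d a x b = d a x + d x b ≡ d a b

between-reflˡ : ∀ {A : Set} {d : A → A → ℕ} → (∀ a → d a a ≡ 0) → ∀ a b → Between d a a b
between-reflˡ {d = d} d-refl a b = cong (_+ d a b) (d-refl a)

between-reflʳ : ∀ {A : Set} {d : A → A → ℕ} → (∀ a → d a a ≡ 0) → ∀ a b → Between d a b b
between-reflʳ {d = d} d-refl a b = trans (cong (d a b +_) (d-refl b)) (+-identityʳ (d a b))

module Walks (G : Graph) where
  private
    variable
      u v w : V G

  infixr 5 _++ʷ_
  _++ʷ_ : Walk G u w → Walk G w v → Walk G u v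
  [] ++ʷ q = q
  (e ∷ p) ++ʷ q = e ∷ (p ++ʷ q)

  length-++ʷ : (p : Walk G u w) (q : Walk G w v) →
               walkLength G (p ++ʷ q) ≡ walkLength G p + walkLength G q
  length-++ʷ [] q = refl
  length-++ʷ (e ∷ p) q = cong suc (length-++ʷ p q)

  ∈-vertices-++ʷ⁻ : ∀ {y} (p : Walk G u w) (q : Walk G w v) →
                    y ∈ vertices G (p ++ʷ q) → y ∈ vertices G p ⊎ y ∈ vertices G q
  ∈-vertices-++ʷ⁻ [] q y∈q = inj₂ y∈q
  ∈-vertices-++ʷ⁻ (e ∷ p) q (here y≡u) = inj₁ (here y≡u)
  ∈-vertices-++ʷ⁻ (e ∷ p) q (there y∈pq) with ∈-vertices-++ʷ⁻ p q y∈pq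
  ... | inj₁ y∈p = inj₁ (there y∈p)
  ... | inj₂ y∈q = inj₂ y∈q

  -- With C = (_∈ X) this is the side condition of Visible X.
  AvoidsInside : (V G → Set) → ∀ {u v} → Walk G u v → Set
  AvoidsInside C {u} {v} p = ∀ y → y ∈ vertices G p → C y → y ≡ u ⊎ y ≡ v

  avoidsInside-++ʷ : ∀ {C} (p : Walk G u w) (q : Walk G w v) → (C w → w ≡ u ⊎ w ≡ v) →
                     AvoidsInside C p → AvoidsInside C q → AvoidsInside C (p ++ʷ q)
  avoidsInside-++ʷ p q at-w avoid-p avoid-q y y∈pq y∈C with ∈-vertices-++ʷ⁻ p q y∈pq
  ... | inj₁ y∈p = [ inj₁ , (λ { refl → at-w y∈C }) ]′ (avoid-p y y∈p y∈C)
  ... | inj₂ y∈q = [ (λ { refl → at-w y∈C }) , inj₂ ]′ (avoid-q y y∈q y∈C)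

  AvoidingGeodesic : (V G → V G → ℕ) → (V G → Set) → V G → V G → Set
  AvoidingGeodesic d C u v = Σ[ p ∈ Walk G u v ] (walkLength G p ≡ d u v × AvoidsInside C p)

  avoidingGeodesic-++ʷ : ∀ {d C u} w {v} → Between d u w v → (C w → w ≡ u ⊎ w ≡ v) →
                         AvoidingGeodesic d C u w → AvoidingGeodesic d C w v →
                         AvoidingGeodesic d C u v
  avoidingGeodesic-++ʷ w between at-w (p , |p|≡d , avoid-p) (q , |q|≡d , avoid-q) =
    p ++ʷ q ,
    trans (length-++ʷ p q) (trans (cong₂ _+_ |p|≡d |q|≡d) between) ,
    avoidsInside-++ʷ p q at-w avoid-p avoid-q

module DistanceLowerBound (G : Graph) (d : V G → V G → ℕ) (d-refl : ∀ v → d v v ≡ 0)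
                          (d-step : ∀ {u w v} → Adj G u w → d u v ≤ suc (d w v)) where
  private
    variable
      u v : V G

  d≤length : (p : Walk G u v) → d u v ≤ walkLength G p
  d≤length {v = v} [] = ≤-reflexive (d-refl v)
  d≤length (e ∷ p) = ≤-trans (d-step e) (s≤s (d≤length p))

  d≤length-from : ∀ {y} (p : Walk G u v) → y ∈ vertices G p → d y v ≤ walkLength G p
  d≤length-from [] (here refl) = d≤length []
  d≤length-from (e ∷ p) (here refl) = d≤length (e ∷ p)
  d≤length-from (e ∷ p) (there y∈p) = m≤n⇒m≤1+n (d≤length-from p y∈p)

  -- u cannot recur on p: every vertex of p is within walkLength p of v,
  -- but d u v = 1 + walkLength p.
  length≡d⇒IsPath : (p : Walk G u v) → walkLength G p ≡ d u v → IsPath G p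
  length≡d⇒IsPath [] _ = [] ∷ []
  length≡d⇒IsPath {u} {v} (_∷_ {w = w} e p) |p|+1≡d =
    ListAll.tabulate
      (λ {y} y∈p u≡y → 1+n≰n (subst (_≤ walkLength G p)
                                     (trans (cong (λ z → d z v) (sym u≡y)) (sym |p|+1≡d))
                                     (d≤length-from p y∈p)))
    ∷ length≡d⇒IsPath p |p|≡d
    where
      |p|≡d : walkLength G p ≡ d w v
      |p|≡d = ≤-antisym (s≤s⁻¹ (≤-trans (≤-reflexive |p|+1≡d) (d-step e))) (d≤length p)

  length≡d⇒IsShortestPath : (p : Walk G u v) → walkLength G p ≡ d u v → IsShortestPath G p
  length≡d⇒IsShortestPath p |p|≡d =
    length≡d⇒IsPath p |p|≡d , λ q _ → ≤-trans (≤-reflexive |p|≡d) (d≤length q)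

Loopless : Graph → Set
Loopless G = ∀ x → ¬ Adj G x x

record IsolatedMidpoint (G : Graph) (x : V G) : Set where
  field
    {left right} : V G
    left≢right   : left ≢ right
    left≁right   : ¬ Adj G left right
    left∼x       : Adj G left x
    x∼right      : Adj G x right
    midpoint-unique : ∀ w → Adj G left w → Adj G w right → w ≡ x

module _ {G : Graph} (loopless : Loopless G) where

  -- Every shortest path from left to right is left, x, right.
  isolatedMidpoint-∉ : ∀ {x X} → IsolatedMidpoint G x → IsTotalMutualVisibilitySet G X → x ∉ X
  isolatedMidpoint-∉ {x} {X} mid tmv x∈X
    with tmv (IsolatedMidpoint.left mid) (IsolatedMidpoint.right mid)
  ... | p , (_ , shortest) , avoids = blocked p (shortest viaX viaX-path) avoids
    where
      open IsolatedMidpoint mid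
      left≢x : left ≢ x
      left≢x refl = loopless x left∼x
      x≢right : x ≢ right
      x≢right refl = loopless x x∼right
      viaX : Walk G left right
      viaX = left∼x ∷ x∼right ∷ []
      viaX-path : IsPath G viaX
      viaX-path = (left≢x ∷ left≢right ∷ []) ∷ (x≢right ∷ []) ∷ [] ∷ []
      blocked : (q : Walk G left right) → walkLength G q ≤ 2 →
                Walks.AvoidsInside G (_∈ X) q → ⊥
      blocked [] _ _ = left≢right refl
      blocked (e ∷ []) _ _ = left≁right e
      blocked (_∷_ {w = w} e₁ (e₂ ∷ [])) _ avoids with midpoint-unique w e₁ e₂
      ... | refl = [ left≢x ∘ sym , x≢right ]′ (avoids x (there (here refl)) x∈X)
      blocked (_ ∷ _ ∷ _ ∷ _) (s≤s (s≤s ())) _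

-- dist-refl and dist-step make dist a lower bound on walk lengths, which geodesic
-- attains: dist is the graph distance.
record Cornered (G : Graph) (k : ℕ) : Set₁ where
  open Walks G using (AvoidingGeodesic)
  field
    loopless       : Loopless G
    dist           : V G → V G → ℕ
    dist-refl      : ∀ v → dist v v ≡ 0
    dist-step      : ∀ {u w v} → Adj G u w → dist u v ≤ suc (dist w v)
    corners        : List (V G)
    corners-unique : Unique corners
    length-corners : length corners ≡ 2 ^ k
    corner?        : ∀ x → Dec (x ∈ corners)
    nonCorner⇒isolatedMidpoint : ∀ {x} → x ∉ corners → IsolatedMidpoint G x
    geodesic       : ∀ u v → AvoidingGeodesic dist (_∈ corners) u v
    waypoint       : ∀ a b → Σ[ x ∈ V G ] (Between dist a x b × (x ∈ corners → a ≡ x × x ≡ b))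

cornered⇒μt≡ : ∀ {G k} → Cornered G k → μt≡ G (2 ^ k)
cornered⇒μt≡ {G} {k} cornered = (corners , corners-unique , cornersVisible , length-corners) , bound
  where
    open Cornered cornered
    open DistanceLowerBound G dist dist-refl dist-step

    cornersVisible : IsTotalMutualVisibilitySet G corners
    cornersVisible u v with geodesic u v
    ... | p , |p|≡d , avoids = p , length≡d⇒IsShortestPath p |p|≡d , avoids

    bound : ∀ X → Unique X → IsTotalMutualVisibilitySet G X → length X ≤ 2 ^ k
    bound X X-unique X-tmv = subst (length X ≤_) length-corners
      (unique-⊆⇒length≤ X-unique corners-unique X⊆corners)
      where
        X⊆corners : ∀ {x} → x ∈ X → x ∈ corners
        X⊆corners {x} x∈X with corner? x
        ... | yes x∈corners = x∈corners
        ... | no x∉corners =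
          ⊥-elim (isolatedMidpoint-∉ loopless (nonCorner⇒isolatedMidpoint x∉corners) X-tmv x∈X)

module Product (G H : Graph) where
  private
    variable
      a b : V G
      g h : V H

  inG : (h : V H) → Walk G a b → Walk (G □ H) (a , h) (b , h)
  inG h [] = []
  inG h (e ∷ p) = inj₁ (e , refl) ∷ inG h p

  inH : (a : V G) → Walk H g h → Walk (G □ H) (a , g) (a , h)
  inH a [] = []
  inH a (e ∷ p) = inj₂ (refl , e) ∷ inH a p

  length-inG : ∀ h (p : Walk G a b) → walkLength (G □ H) (inG h p) ≡ walkLength G p
  length-inG h [] = refl
  length-inG h (e ∷ p) = cong suc (length-inG h p)

  length-inH : ∀ a (p : Walk H g h) → walkLength (G □ H) (inH a p) ≡ walkLength H p
  length-inH a [] = refl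
  length-inH a (e ∷ p) = cong suc (length-inH a p)

  vertices-inG : ∀ h (p : Walk G a b) → vertices (G □ H) (inG h p) ≡ map (_, h) (vertices G p)
  vertices-inG h [] = refl
  vertices-inG h (e ∷ p) = cong (_ ∷_) (vertices-inG h p)

  vertices-inH : ∀ a (p : Walk H g h) → vertices (G □ H) (inH a p) ≡ map (a ,_) (vertices H p)
  vertices-inH a [] = refl
  vertices-inH a (e ∷ p) = cong (_ ∷_) (vertices-inH a p)

  avoidsInside-inG : ∀ {CG C} h (p : Walk G a b) → (∀ {c} → C (c , h) → CG c) →
                     Walks.AvoidsInside G CG p → Walks.AvoidsInside (G □ H) C (inG h p)
  avoidsInside-inG h p C⇒CG avoids y y∈p y∈C
    with ∈-map⁻ (_, h) (subst (y ∈_) (vertices-inG h p) y∈p)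
  ... | c , c∈p , refl with avoids c c∈p (C⇒CG y∈C)
  ... | inj₁ refl = inj₁ refl
  ... | inj₂ refl = inj₂ refl

  avoidsInside-inH : ∀ {CH C} a (p : Walk H g h) → (∀ {c} → C (a , c) → CH c) →
                     Walks.AvoidsInside H CH p → Walks.AvoidsInside (G □ H) C (inH a p)
  avoidsInside-inH a p C⇒CH avoids y y∈p y∈C
    with ∈-map⁻ (a ,_) (subst (y ∈_) (vertices-inH a p) y∈p)
  ... | c , c∈p , refl with avoids c c∈p (C⇒CH y∈C)
  ... | inj₁ refl = inj₁ refl
  ... | inj₂ refl = inj₂ refl

  _⊕_ : (V G → V G → ℕ) → (V H → V H → ℕ) → V (G □ H) → V (G □ H) → ℕ
  (dG ⊕ dH) (a , g) (b , h) = dG a b + dH g h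

  dist-step-⊕ : ∀ {dG dH} →
                (∀ {u w v} → Adj G u w → dG u v ≤ suc (dG w v)) →
                (∀ {u w v} → Adj H u w → dH u v ≤ suc (dH w v)) →
                ∀ {u w v} → Adj (G □ H) u w → (dG ⊕ dH) u v ≤ suc ((dG ⊕ dH) w v)
  dist-step-⊕ {dH = dH} stepG stepH {_} {_} {b , h} (inj₁ (e , refl)) =
    +-monoˡ-≤ (dH _ h) (stepG e)
  dist-step-⊕ {dG} stepG stepH {a , _} {_ , _} {b , h} (inj₂ (refl , e)) =
    ≤-trans (+-monoʳ-≤ (dG a b) (stepH e)) (≤-reflexive (+-suc (dG a b) _))

  between-⊕ : ∀ {dG dH a x b g y h} → Between dG a x b → Between dH g y h →
              Between (dG ⊕ dH) (a , g) (x , y) (b , h)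
  between-⊕ {dG} {dH} {a} {x} {b} {g} {y} {h} axb gyh =
    trans (interchange (dG a x) (dH g y) (dG x b) (dH y h)) (cong₂ _+_ axb gyh)

  loopless-□ : Loopless G → Loopless H → Loopless (G □ H)
  loopless-□ loopG loopH (a , g) (inj₁ (e , _)) = loopG a e
  loopless-□ loopG loopH (a , g) (inj₂ (_ , e)) = loopH g e

  isolatedMidpoint-□ˡ : Loopless H → ∀ {a} g → IsolatedMidpoint G a →
                        IsolatedMidpoint (G □ H) (a , g)
  isolatedMidpoint-□ˡ loopH {a} g mid = record
    { left≢right = λ eq → left≢right (cong proj₁ eq)
    ; left≁right = λ { (inj₁ (e , _)) → left≁right e ; (inj₂ (eq , _)) → left≢right eq }
    ; left∼x = inj₁ (left∼x , refl)
    ; x∼right = inj₁ (x∼right , refl)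
    ; midpoint-unique = unique
    }
    where
      open IsolatedMidpoint mid
      unique : ∀ w → Adj (G □ H) (left , g) w → Adj (G □ H) w (right , g) → w ≡ (a , g)
      unique (c , _) (inj₁ (e₁ , refl)) (inj₁ (e₂ , refl)) = cong (_, g) (midpoint-unique c e₁ e₂)
      unique _ (inj₁ (_ , refl)) (inj₂ (_ , e)) = ⊥-elim (loopH g e)
      unique _ (inj₂ (_ , e)) (inj₁ (_ , refl)) = ⊥-elim (loopH g e)
      unique _ (inj₂ (refl , _)) (inj₂ (refl , _)) = ⊥-elim (left≢right refl)

  isolatedMidpoint-□ʳ : Loopless G → ∀ a {g} → IsolatedMidpoint H g →
                        IsolatedMidpoint (G □ H) (a , g)
  isolatedMidpoint-□ʳ loopG a {g} mid = record
    { left≢right = λ eq → left≢right (cong proj₂ eq)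
    ; left≁right = λ { (inj₁ (e , _)) → loopG a e ; (inj₂ (_ , e)) → left≁right e }
    ; left∼x = inj₂ (refl , left∼x)
    ; x∼right = inj₂ (refl , x∼right)
    ; midpoint-unique = unique
    }
    where
      open IsolatedMidpoint mid
      unique : ∀ w → Adj (G □ H) (a , left) w → Adj (G □ H) w (a , right) → w ≡ (a , g)
      unique _ (inj₁ (_ , refl)) (inj₁ (_ , refl)) = ⊥-elim (left≢right refl)
      unique _ (inj₁ (e , _)) (inj₂ (refl , _)) = ⊥-elim (loopG a e)
      unique _ (inj₂ (refl , _)) (inj₁ (e , _)) = ⊥-elim (loopG a e)
      unique (_ , c) (inj₂ (refl , e₁)) (inj₂ (_ , e₂)) = cong (a ,_) (midpoint-unique c e₁ e₂)

module _ {G H k l} (𝒢 : Cornered G k) (ℋ : Cornered H l) where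
  private
    module 𝒢 = Cornered 𝒢
    module ℋ = Cornered ℋ
    open Product G H
    open Walks (G □ H) using (AvoidingGeodesic; avoidingGeodesic-++ʷ)

    dist : V (G □ H) → V (G □ H) → ℕ
    dist = 𝒢.dist ⊕ ℋ.dist

    dist-refl : ∀ v → dist v v ≡ 0
    dist-refl (a , g) = cong₂ _+_ (𝒢.dist-refl a) (ℋ.dist-refl g)

    corners : List (V (G □ H))
    corners = cartesianProduct 𝒢.corners ℋ.corners

    cornerˡ : ∀ {a g} → (a , g) ∈ corners → a ∈ 𝒢.corners
    cornerˡ = proj₁ ∘ ∈-cartesianProduct⁻ 𝒢.corners ℋ.corners

    cornerʳ : ∀ {a g} → (a , g) ∈ corners → g ∈ ℋ.corners
    cornerʳ = proj₂ ∘ ∈-cartesianProduct⁻ 𝒢.corners ℋ.corners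

    Geodesic : V (G □ H) → V (G □ H) → Set
    Geodesic = AvoidingGeodesic dist (_∈ corners)

    geodesicInG : ∀ {a b} h → Walks.AvoidingGeodesic G 𝒢.dist (_∈ 𝒢.corners) a b →
                  Geodesic (a , h) (b , h)
    geodesicInG {a} {b} h (p , |p|≡d , avoids) =
      inG h p ,
      trans (length-inG h p) (trans |p|≡d (sym (trans (cong (𝒢.dist a b +_) (ℋ.dist-refl h))
                                                       (+-identityʳ _)))) ,
      avoidsInside-inG h p cornerˡ avoids

    geodesicInH : ∀ a {g h} → Walks.AvoidingGeodesic H ℋ.dist (_∈ ℋ.corners) g h →
                  Geodesic (a , g) (a , h)
    geodesicInH a (p , |p|≡d , avoids) =
      inH a p ,
      trans (length-inH a p) (trans |p|≡d (sym (cong (_+ _) (𝒢.dist-refl a)))) ,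
      avoidsInside-inH a p cornerʳ avoids

    geodesic : ∀ u v → Geodesic u v
    geodesic (a , g) (b , h) with 𝒢.waypoint a b
    ... | x , axb , x-corner =
      avoidingGeodesic-++ʷ {dist} (x , g) xg-between
        (inj₁ ∘ cong (_, g) ∘ sym ∘ proj₁ ∘ x-corner ∘ cornerˡ)
        (geodesicInG g (𝒢.geodesic a x))
        (avoidingGeodesic-++ʷ {dist} (x , h) xh-between
          (inj₂ ∘ cong (_, h) ∘ proj₂ ∘ x-corner ∘ cornerˡ)
          (geodesicInH x (ℋ.geodesic g h))
          (geodesicInG h (𝒢.geodesic x b)))
      where
        xg-between : Between dist (a , g) (x , g) (b , h)
        xg-between = between-⊕ {𝒢.dist} {ℋ.dist} axb (between-reflˡ ℋ.dist-refl g h)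
        xh-between : Between dist (x , g) (x , h) (b , h)
        xh-between = between-⊕ {𝒢.dist} {ℋ.dist} (between-reflˡ 𝒢.dist-refl x b)
                                                  (between-reflʳ ℋ.dist-refl g h)

    waypoint : ∀ u v → Σ[ z ∈ V (G □ H) ] (Between dist u z v × (z ∈ corners → u ≡ z × z ≡ v))
    waypoint (a , g) (b , h) with 𝒢.waypoint a b | ℋ.waypoint g h
    ... | x , axb , x-corner | y , gyh , y-corner =
      (x , y) , between-⊕ {𝒢.dist} {ℋ.dist} axb gyh , corner
      where
        corner : (x , y) ∈ corners → (a , g) ≡ (x , y) × (x , y) ≡ (b , h)
        corner xy∈ with x-corner (cornerˡ xy∈) | y-corner (cornerʳ xy∈)
        ... | refl , refl | refl , refl = refl , refl

    corner? : ∀ v → Dec (v ∈ corners)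
    corner? (a , g) = Dec.map′ (λ (a∈ , g∈) → ∈-cartesianProduct⁺ a∈ g∈)
                               (∈-cartesianProduct⁻ 𝒢.corners ℋ.corners)
                               (𝒢.corner? a ×-dec ℋ.corner? g)

    nonCorner⇒isolatedMidpoint : ∀ {v} → v ∉ corners → IsolatedMidpoint (G □ H) v
    nonCorner⇒isolatedMidpoint {a , g} ag∉ with 𝒢.corner? a
    ... | no a∉ = isolatedMidpoint-□ˡ ℋ.loopless g (𝒢.nonCorner⇒isolatedMidpoint a∉)
    ... | yes a∈ = isolatedMidpoint-□ʳ 𝒢.loopless a
                     (ℋ.nonCorner⇒isolatedMidpoint (λ g∈ → ag∉ (∈-cartesianProduct⁺ a∈ g∈)))

  Cornered-□ : Cornered (G □ H) (k + l)
  Cornered-□ = record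
    { loopless = loopless-□ 𝒢.loopless ℋ.loopless
    ; dist = dist
    ; dist-refl = dist-refl
    ; dist-step = dist-step-⊕ {𝒢.dist} {ℋ.dist} 𝒢.dist-step ℋ.dist-step
    ; corners = corners
    ; corners-unique = Unique.cartesianProduct⁺ 𝒢.corners-unique ℋ.corners-unique
    ; length-corners = begin
        length corners                       ≡⟨ length-cartesianProduct 𝒢.corners ℋ.corners ⟩
        length 𝒢.corners * length ℋ.corners  ≡⟨ cong₂ _*_ 𝒢.length-corners ℋ.length-corners ⟩
        2 ^ k * 2 ^ l                        ≡⟨ ^-distribˡ-+-* 2 k l ⟨
        2 ^ (k + l)                          ∎
    ; corner? = corner?
    ; nonCorner⇒isolatedMidpoint = nonCorner⇒isolatedMidpoint
    ; geodesic = geodesic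
    ; waypoint = waypoint
    }
    where open ≡-Reasoning

module PathGraph {n : ℕ} where
  private
    variable
      i j u w : Fin n

  dist : Fin n → Fin n → ℕ
  dist i j = ∣ toℕ i - toℕ j ∣

  dist-refl : ∀ i → dist i i ≡ 0
  dist-refl i = ∣n-n∣≡0 (toℕ i)

  loopless : Loopless (P n)
  loopless i (inj₁ eq) = 1+n≢n eq
  loopless i (inj₂ eq) = 1+n≢n eq

  adjacent⇒dist≡1 : Adj (P n) u w → dist u w ≡ 1
  adjacent⇒dist≡1 {u} (inj₁ eq) = trans (cong (∣ toℕ u -_∣) (sym eq)) (∣n-1+n∣≡1 (toℕ u))
    where
      ∣n-1+n∣≡1 : ∀ t → ∣ t - suc t ∣ ≡ 1
      ∣n-1+n∣≡1 t = trans (cong (∣ t -_∣) (+-comm 1 t)) (∣m-m+n∣≡n t 1)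
  adjacent⇒dist≡1 {u} {w} (inj₂ eq) =
    trans (∣-∣-comm (toℕ u) (toℕ w)) (adjacent⇒dist≡1 {w} {u} (inj₁ eq))

  dist-step : ∀ {u w v} → Adj (P n) u w → dist u v ≤ suc (dist w v)
  dist-step {u} {w} {v} e =
    ≤-trans (∣-∣-triangle (toℕ u) (toℕ w) (toℕ v))
            (≤-reflexive (cong (_+ dist w v) (adjacent⇒dist≡1 e)))

  Within : Fin n → Fin n → Fin n → Set
  Within lo hi y = toℕ lo ≤ toℕ y × toℕ y ≤ toℕ hi

  ascend : ∀ k (i j : Fin n) → toℕ i + k ≡ toℕ j →
           Σ[ p ∈ Walk (P n) i j ]
             (walkLength (P n) p ≡ k × ListAll.All (Within i j) (vertices (P n) p))
  ascend zero i j i+0≡j with toℕ-injective (trans (sym (+-identityʳ (toℕ i))) i+0≡j)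
  ... | refl = [] , refl , (≤-refl , ≤-refl) ∷ []
  ascend (suc k) i j i+1+k≡j =
    let (p , |p|≡k , within) = ascend k next j next+k≡j
    in  inj₁ (sym toℕ-next) ∷ p , cong suc |p|≡k ,
        (≤-refl , <⇒≤ i<j) ∷
        ListAll.map (λ (next≤y , y≤j) → ≤-trans (n≤1+n _) (subst (_≤ _) toℕ-next next≤y) , y≤j)
                    within
    where
      i<j : toℕ i < toℕ j
      i<j = subst (toℕ i <_) i+1+k≡j (m<m+n (toℕ i) z<s)
      next : Fin n
      next = fromℕ< (≤-<-trans i<j (toℕ<n j))
      toℕ-next : toℕ next ≡ suc (toℕ i)
      toℕ-next = toℕ-fromℕ< _
      next+k≡j : toℕ next + k ≡ toℕ j
      next+k≡j = trans (cong (_+ k) toℕ-next) (trans (sym (+-suc (toℕ i) k)) i+1+k≡j)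

  descend : ∀ k (i j : Fin n) → toℕ j + k ≡ toℕ i →
            Σ[ p ∈ Walk (P n) i j ]
              (walkLength (P n) p ≡ k × ListAll.All (Within j i) (vertices (P n) p))
  descend zero i j j+0≡i with toℕ-injective (trans (sym (+-identityʳ (toℕ j))) j+0≡i)
  ... | refl = [] , refl , (≤-refl , ≤-refl) ∷ []
  descend (suc k) i j j+1+k≡i =
    let (p , |p|≡k , within) = descend k prev j (sym toℕ-prev)
    in  inj₂ 1+prev≡i ∷ p , cong suc |p|≡k ,
        (<⇒≤ j<i , ≤-refl) ∷
        ListAll.map (λ (j≤y , y≤prev) → j≤y , ≤-trans y≤prev (≤-trans (n≤1+n _) (≤-reflexive 1+prev≡i)))
                    within
    where
      j<i : toℕ j < toℕ i
      j<i = subst (toℕ j <_) j+1+k≡i (m<m+n (toℕ j) z<s)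
      j+k<n : toℕ j + k < n
      j+k<n = <-trans (≤-reflexive (trans (sym (+-suc (toℕ j) k)) j+1+k≡i)) (toℕ<n i)
      prev : Fin n
      prev = fromℕ< j+k<n
      toℕ-prev : toℕ prev ≡ toℕ j + k
      toℕ-prev = toℕ-fromℕ< j+k<n
      1+prev≡i : suc (toℕ prev) ≡ toℕ i
      1+prev≡i = trans (cong suc toℕ-prev) (trans (sym (+-suc (toℕ j) k)) j+1+k≡i)

  isolatedMidpoint : ∀ {u x v} → suc (toℕ u) ≡ toℕ x → suc (toℕ x) ≡ toℕ v →
                     IsolatedMidpoint (P n) x
  isolatedMidpoint {u} {x} {v} u+1≡x x+1≡v = record
    { left≢right = λ u≡v → m≢1+n+m (toℕ u) {1} (trans (cong toℕ u≡v) (sym u+2≡v))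
    ; left≁right = λ { (inj₁ u+1≡v) → m≢1+n+m (suc (toℕ u)) {0} (trans u+1≡v (sym u+2≡v))
                     ; (inj₂ v+1≡u) →
                         m≢1+n+m (toℕ u) {2} (trans (sym v+1≡u) (cong suc (sym u+2≡v))) }
    ; left∼x = inj₁ u+1≡x
    ; x∼right = inj₁ x+1≡v
    ; midpoint-unique = unique
    }
    where
      u+2≡v : suc (suc (toℕ u)) ≡ toℕ v
      u+2≡v = trans (cong suc u+1≡x) x+1≡v
      unique : ∀ w → Adj (P n) u w → Adj (P n) w v → w ≡ x
      unique w (inj₁ u+1≡w) _ = toℕ-injective (trans (sym u+1≡w) u+1≡x)
      unique w (inj₂ w+1≡u) (inj₁ w+1≡v) =
        ⊥-elim (m≢1+n+m (toℕ u) {1} (trans (sym w+1≡u) (trans w+1≡v (sym u+2≡v))))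
      unique w (inj₂ w+1≡u) (inj₂ v+1≡w) =
        ⊥-elim (m≢1+n+m (toℕ u) {3}
                  (trans (sym w+1≡u) (trans (cong suc (sym v+1≡w)) (cong (suc ∘ suc) (sym u+2≡v)))))

Cornered-P : ∀ {n} → 3 ≤ n → Cornered (P n) 1
Cornered-P {n@(suc (suc (suc m)))} (s≤s (s≤s (s≤s _))) = record
  { loopless = loopless
  ; dist = dist
  ; dist-refl = dist-refl
  ; dist-step = dist-step
  ; corners = ends
  ; corners-unique = ((λ ()) ∷ []) ∷ [] ∷ []
  ; length-corners = refl
  ; corner? = _∈? ends
  ; nonCorner⇒isolatedMidpoint = nonEnd⇒isolatedMidpoint
  ; geodesic = geodesic
  ; waypoint = waypoint
  }
  where
    open PathGraph {n}
    open Data.List.Membership.DecPropositional _≟ᶠ_ using (_∈?_)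
    open Walks (P n) using (AvoidingGeodesic)

    last : Fin n
    last = fromℕ (suc (suc m))

    ends : List (Fin n)
    ends = fz ∷ last ∷ []

    within⇒end : ∀ {lo hi y} → Within lo hi y → y ∈ ends → y ≡ lo ⊎ y ≡ hi
    within⇒end (lo≤0 , _) (here refl) = inj₁ (toℕ-injective (sym (n≤0⇒n≡0 lo≤0)))
    within⇒end {hi = hi} (_ , last≤hi) (there (here refl)) =
      inj₂ (toℕ-injective
              (≤-antisym last≤hi (subst (toℕ hi ≤_) (sym (toℕ-fromℕ _)) (s≤s⁻¹ (toℕ<n hi)))))

    geodesic : ∀ i j → AvoidingGeodesic dist (_∈ ends) i j
    geodesic i j with ≤-total (toℕ i) (toℕ j)
    ... | inj₁ i≤j =
      let (p , |p|≡j∸i , within) = ascend (toℕ j ∸ toℕ i) i j (m+[n∸m]≡n i≤j)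
      in  p , trans |p|≡j∸i (sym (m≤n⇒∣m-n∣≡n∸m i≤j)) ,
          λ y y∈p y∈ends → within⇒end (ListAll.lookup within y∈p) y∈ends
    ... | inj₂ j≤i =
      let (p , |p|≡i∸j , within) = descend (toℕ i ∸ toℕ j) i j (m+[n∸m]≡n j≤i)
      in  p , trans |p|≡i∸j (sym (m≤n⇒∣n-m∣≡n∸m j≤i)) ,
          λ y y∈p y∈ends → swap (within⇒end (ListAll.lookup within y∈p) y∈ends)

    second : Fin n
    second = fs fz

    second∉ends : second ∉ ends
    second∉ends (here ())
    second∉ends (there (here ()))

    waypoint : ∀ a b → Σ[ x ∈ Fin n ] (Between dist a x b × (x ∈ ends → a ≡ x × x ≡ b))
    waypoint a b with b ∈? ends | a ∈? ends
    ... | no b∉ | _ = b , between-reflʳ {d = dist} dist-refl a b , ⊥-elim ∘ b∉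
    ... | yes _ | no a∉ = a , between-reflˡ {d = dist} dist-refl a b , ⊥-elim ∘ a∉
    ... | yes (here refl) | yes (here refl) =
      a , between-reflˡ {d = dist} dist-refl a b , λ _ → refl , refl
    ... | yes (there (here refl)) | yes (there (here refl)) =
      a , between-reflˡ {d = dist} dist-refl a b , λ _ → refl , refl
    ... | yes (there (here refl)) | yes (here refl) = second , refl , ⊥-elim ∘ second∉ends
    ... | yes (here refl) | yes (there (here refl)) =
      second , +-comm (suc (toℕ (fromℕ m))) 1 , ⊥-elim ∘ second∉ends

    nonEnd⇒isolatedMidpoint : ∀ {x} → x ∉ ends → IsolatedMidpoint (P n) x
    nonEnd⇒isolatedMidpoint {fz} x∉ = ⊥-elim (x∉ (here refl))
    nonEnd⇒isolatedMidpoint {fs y} x∉ =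
      isolatedMidpoint {inject₁ y} {fs y} {fs (fs (lower₁ y y≢last))}
        (cong suc (toℕ-inject₁ y)) (cong (suc ∘ suc) (sym (toℕ-lower₁ y y≢last)))
      where
        y≢last : suc m ≢ toℕ y
        y≢last eq =
          x∉ (there (here (cong fs (toℕ-injective (trans (sym eq) (sym (toℕ-fromℕ (suc m))))))))

Cornered-Grid : ∀ {k} (ns : Vec ℕ (suc k)) → All (3 ≤_) ns → Cornered (Grid ns) (suc k)
Cornered-Grid (n ∷ []) (3≤n ∷ []) = Cornered-P 3≤n
Cornered-Grid (n ∷ m ∷ ns) (3≤n ∷ 3≤ns) =
  Cornered-□ (Cornered-P 3≤n) (Cornered-Grid (m ∷ ns) 3≤ns)

corollary4p2 : (k : ℕ) (ns : Vec ℕ k) → 2 ≤ k → All (3 ≤_) ns →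
    μt≡ (Grid ns) (2 ^ k)
corollary4p2 (suc k) ns _ 3≤ns = cornered⇒μt≡ (Cornered-Grid ns 3≤ns)
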